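{- Let $n\geq 2$ and $r\geq 3$. (1) The Cartesian product $K_r\,\square\, K_r\,\square\cdots\square\, K_r$ of $n$ copies of $K_r$ and its complement are hulls. (2) The categorical product $K_r\times K_r\times\cdots\times K_r$ of $n$ copies of $K_r$ and its complement are hulls.
   Context: Both products have vertex set $\{1,\dots,r\}^n$. In the Cartesian product two vertices are adjacent iff they differ in exactly one coordinate (this is the Hamming graph $H(n,r)$); in the categorical product two vertices are adjacent iff they differ in every coordinate. For a set $M$ of transformations of the vertex set $V$ (acting on the right), $\mathrm{Gr}(M)$ is the graph on $V$ in which distinct $v,w$ are adjacent iff no $f\in M$ satisfies $vf=wf$. The hull of a graph $X$ is $\mathrm{Hull}(X)=\mathrm{Gr}(\mathrm{End}(X))$, and $X$ is a hull if $X=\mathrm{Hull}(X)$. -}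

module Defs where

open import Data.Nat using (ℕ)
open import Data.Fin using (Fin)
open import Data.Vec using (Vec; lookup)
open import Data.Product using (Σ; ∃; _×_; _,_)
open import Relation.Nullary using (¬_)
open import Relation.Binary.PropositionalEquality using (_≡_; _≢_)
open import Function.Bundles using (_⇔_)

Graph : Set → Set₁
Graph V = V → V → Set

Vertex : ℕ → ℕ → Set
Vertex r n = Vec (Fin r) n

CartesianPowK : (r n : ℕ) → Graph (Vertex r n)
CartesianPowK r n v w =
  Σ (Fin n) λ i → (lookup v i ≢ lookup w i) × (∀ j → j ≢ i → lookup v j ≡ lookup w j)

CategoricalPowK : (r n : ℕ) → Graph (Vertex r n)
CategoricalPowK r n v w = ∀ i → lookup v i ≢ lookup w i

Complement : {V : Set} → Graph V → Graph V
Complement X v w = (v ≢ w) × ¬ X v w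

IsEndo : {V : Set} → Graph V → (V → V) → Set
IsEndo X f = ∀ v w → X v w → X (f v) (f w)

Gr : {V : Set} → ((V → V) → Set) → Graph V
Gr M v w = (v ≢ w) × (∀ f → M f → f v ≢ f w)

Hull : {V : Set} → Graph V → Graph V
Hull X = Gr (IsEndo X)

IsHull : {V : Set} → Graph V → Set
IsHull X = ∀ v w → X v w ⇔ Hull X v w

module Submission where

-- Every loopless graph is contained in its hull, so X is a hull as soon as each pair of
-- distinct non-adjacent vertices is identified by some endomorphism of X (hull-criterion);
-- for a complement, as soon as each edge of X is identified by an endomorphism of the
-- complement (complement-hull-criterion).  The four parts then need four families of
-- endomorphisms, all built from arithmetic in the cyclic group ℤ_r on Fin r:
--  * H(n,r): proper r-colourings c of H(n,r) are built coordinate by coordinate as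
--    (h ∷ t) ↦ h ⊕ π (c t) with π an injective relabelling of colours; choosing π well,
--    any two vertices at distance ≥ 2 receive the same colour (this needs r ≥ 3), and
--    c followed by the embedding of K_r as a line of H(n,r) merges them.
--  * complement of H(n,r): "folding" coordinate i onto a proper colouring of the rest
--    identifies i-neighbours and is an endomorphism of the complement.
--  * categorical power: the maps x ↦ (x_i, …, x_i) identify any two vertices that agree
--    somewhere.
--  * its complement: x ↦ (0, x₀ ⊕ π₁ x₁, …, x₀ ⊕ π_m x_m) with suitable relabellings π_k
--    identifies a given pair of vertices that differ everywhere.
-- The parts hold for all n ≥ 1; only the Hamming graph itself needs r ≥ 3.

open import Defs
open import Data.Nat using (ℕ; zero; suc; _+_; _∸_; _≤_; s≤s; NonZero)
open import Data.Nat.Properties using (+-comm; +-assoc; m+[n∸m]≡n; m∸n+n≡m; <⇒≤)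
open import Data.Nat.DivMod using (_%_; _mod_; %-distribˡ-+; m%n%n≡m%n; [m+n]%n≡m%n; m<n⇒m%n≡m)
open import Data.Fin using (Fin; zero; suc; toℕ)
open import Data.Fin.Properties using (_≟_; toℕ-fromℕ<; toℕ-injective; toℕ<n; suc-injective; any?)
open import Data.Fin.Permutation.Components using (transpose; transpose-inverse)
open import Data.Vec using (Vec; []; _∷_; lookup; tabulate; replicate; _[_]≔_)
open import Data.Vec.Properties
  using (≡-dec; lookup∘update; lookup∘update′; lookup∘tabulate; lookup-replicate; tabulate∘lookup; tabulate-cong)
open import Data.Product using (Σ; _×_; _,_; proj₁; proj₂)
open import Data.Sum using (_⊎_; inj₁; inj₂)
open import Data.Empty using (⊥; ⊥-elim)
open import Function.Bundles using (mk⇔)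
open import Function.Definitions using (Injective)
open import Relation.Nullary using (¬_; yes; no)
open import Relation.Nullary.Decidable using (dec-true; dec-false)
open import Relation.Binary.PropositionalEquality

Loopless : {V : Set} → Graph V → Set
Loopless X = ∀ {v w} → X v w → v ≢ w

MergedByEndo : {V : Set} → Graph V → V → V → Set
MergedByEndo {V} X v w = Σ (V → V) λ f → IsEndo X f × f v ≡ f w

-- Endomorphisms map edges to edges, which in a loopless graph join distinct vertices;
-- hence X ⊆ Hull(X).
edge⇒hull : {V : Set} {X : Graph V} → Loopless X → ∀ {v w} → X v w → Hull X v w
edge⇒hull loopless e = loopless e , λ f f-endo → loopless (f-endo _ _ e)

hull-criterion : {V : Set} {X : Graph V} → Loopless X →
  (∀ v w → v ≢ w → X v w ⊎ MergedByEndo X v w) → IsHull X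
hull-criterion {X = X} loopless split v w = mk⇔ (edge⇒hull loopless) hull⇒edge
  where
  hull⇒edge : Hull X v w → X v w
  hull⇒edge (v≢w , unmerged) with split v w v≢w
  ... | inj₁ edge = edge
  ... | inj₂ (f , f-endo , fv≡fw) = ⊥-elim (unmerged f f-endo fv≡fw)

-- The complement of X is a hull once every edge of X is merged by an endomorphism of the
-- complement (no decidability of X is needed: such a merge refutes adjacency in the hull).
complement-hull-criterion : {V : Set} {X : Graph V} →
  (∀ v w → X v w → MergedByEndo (Complement X) v w) → IsHull (Complement X)
complement-hull-criterion {X = X} merge v w = mk⇔ (edge⇒hull proj₁) hull⇒nonEdge
  where
  hull⇒nonEdge : Hull (Complement X) v w → Complement X v w
  hull⇒nonEdge (v≢w , unmerged) = v≢w , λ edge →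
    let (f , f-endo , fv≡fw) = merge v w edge in unmerged f f-endo fv≡fw

lookup-ext : ∀ {A : Set} {n} {x y : Vec A n} → (∀ i → lookup x i ≡ lookup y i) → x ≡ y
lookup-ext {x = x} {y} same =
  trans (sym (tabulate∘lookup x)) (trans (tabulate-cong same) (tabulate∘lookup y))

module _ {r : ℕ} .{{_ : NonZero r}} where

  0ᶠ : Fin r
  0ᶠ = 0 mod r

  _⊕_ : Fin r → Fin r → Fin r
  x ⊕ y = (toℕ x + toℕ y) mod r

  _⊖_ : Fin r → Fin r → Fin r
  x ⊖ y = (toℕ x + (r ∸ toℕ y)) mod r

  private
    toℕ-mod : ∀ m → toℕ (m mod r) ≡ m % r
    toℕ-mod m = toℕ-fromℕ< _

    %-absorbˡ : ∀ m n → (m % r + n) % r ≡ (m + n) % r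
    %-absorbˡ m n = begin
      (m % r + n) % r           ≡⟨ %-distribˡ-+ (m % r) n r ⟩
      (m % r % r + n % r) % r   ≡⟨ cong (λ k → (k + n % r) % r) (m%n%n≡m%n m r) ⟩
      (m % r + n % r) % r       ≡⟨ %-distribˡ-+ m n r ⟨
      (m + n) % r               ∎
      where open ≡-Reasoning

    toℕ-% : (x : Fin r) → toℕ x % r ≡ toℕ x
    toℕ-% x = m<n⇒m%n≡m (toℕ<n x)

    -- Adding x and r ∸ x, in either order, adds r, which is invisible modulo r.
    add-neg : ∀ (m : ℕ) (x : Fin r) → (m + toℕ x + (r ∸ toℕ x)) % r ≡ m % r
    add-neg m x = trans (cong (_% r) (trans (+-assoc m _ _) (cong (m +_) (m+[n∸m]≡n (<⇒≤ (toℕ<n x))))))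
                        ([m+n]%n≡m%n m r)

    neg-add : ∀ (m : ℕ) (x : Fin r) → (m + (r ∸ toℕ x) + toℕ x) % r ≡ m % r
    neg-add m x = trans (cong (_% r) (trans (+-assoc m _ _) (cong (m +_) (m∸n+n≡m (<⇒≤ (toℕ<n x))))))
                        ([m+n]%n≡m%n m r)

  ⊕-⊖ : ∀ y x → (y ⊕ x) ⊖ x ≡ y
  ⊕-⊖ y x = toℕ-injective (begin
    toℕ ((y ⊕ x) ⊖ x)                          ≡⟨ toℕ-mod _ ⟩
    (toℕ (y ⊕ x) + (r ∸ toℕ x)) % r            ≡⟨ cong (λ k → (k + (r ∸ toℕ x)) % r) (toℕ-mod _) ⟩
    ((toℕ y + toℕ x) % r + (r ∸ toℕ x)) % r    ≡⟨ %-absorbˡ _ _ ⟩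
    (toℕ y + toℕ x + (r ∸ toℕ x)) % r          ≡⟨ add-neg (toℕ y) x ⟩
    toℕ y % r                                  ≡⟨ toℕ-% y ⟩
    toℕ y                                      ∎)
    where open ≡-Reasoning

  ⊖-⊕ : ∀ z x → (z ⊖ x) ⊕ x ≡ z
  ⊖-⊕ z x = toℕ-injective (begin
    toℕ ((z ⊖ x) ⊕ x)                          ≡⟨ toℕ-mod _ ⟩
    (toℕ (z ⊖ x) + toℕ x) % r                  ≡⟨ cong (λ k → (k + toℕ x) % r) (toℕ-mod _) ⟩
    ((toℕ z + (r ∸ toℕ x)) % r + toℕ x) % r    ≡⟨ %-absorbˡ _ _ ⟩
    (toℕ z + (r ∸ toℕ x) + toℕ x) % r          ≡⟨ neg-add (toℕ z) x ⟩
    toℕ z % r                                  ≡⟨ toℕ-% z ⟩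
    toℕ z                                      ∎)
    where open ≡-Reasoning

  ⊕-comm : ∀ x y → x ⊕ y ≡ y ⊕ x
  ⊕-comm x y = cong (_mod r) (+-comm (toℕ x) (toℕ y))

  ⊕-cancelʳ : ∀ {x y s} → x ⊕ s ≡ y ⊕ s → x ≡ y
  ⊕-cancelʳ {x} {y} {s} e = trans (sym (⊕-⊖ x s)) (trans (cong (_⊖ s) e) (⊕-⊖ y s))

  ⊕-cancelˡ : ∀ {s x y} → s ⊕ x ≡ s ⊕ y → x ≡ y
  ⊕-cancelˡ {s} {x} {y} e = ⊕-cancelʳ (trans (⊕-comm x s) (trans e (⊕-comm s y)))

  ⊕-solve : ∀ b c → b ⊕ (c ⊖ b) ≡ c
  ⊕-solve b c = trans (⊕-comm b (c ⊖ b)) (⊖-⊕ c b)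

retarget : ∀ {r} {u u' q : Fin r} → u ≢ u' → u ≢ q →
  Σ (Fin r → Fin r) λ π → Injective _≡_ _≡_ π × π u ≡ u × π u' ≡ q
retarget {u = u} {u'} {q} u≢u' u≢q = transpose u' q , injective , fixes-u , sends-u'
  where
  injective : Injective _≡_ _≡_ (transpose u' q)
  injective e = trans (sym (transpose-inverse q u')) (trans (cong (transpose q u') e) (transpose-inverse q u'))
  fixes-u : transpose u' q u ≡ u
  fixes-u rewrite dec-false (u ≟ u') u≢u' | dec-false (u ≟ q) u≢q = refl
  sends-u' : transpose u' q u' ≡ q
  sends-u' rewrite dec-true (u' ≟ u') refl = refl

avoidTwo : ∀ {r} → 3 ≤ r → (b q : Fin r) → Σ (Fin r) λ s → s ≢ b × s ≢ q
avoidTwo (s≤s (s≤s (s≤s _))) zero zero = suc zero , (λ ()) , (λ ())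
avoidTwo (s≤s (s≤s (s≤s _))) zero (suc zero) = suc (suc zero) , (λ ()) , (λ ())
avoidTwo (s≤s (s≤s (s≤s _))) zero (suc (suc _)) = suc zero , (λ ()) , (λ ())
avoidTwo (s≤s (s≤s (s≤s _))) (suc zero) zero = suc (suc zero) , (λ ()) , (λ ())
avoidTwo (s≤s (s≤s (s≤s _))) (suc (suc _)) zero = suc zero , (λ ()) , (λ ())
avoidTwo (s≤s (s≤s (s≤s _))) (suc _) (suc _) = zero , (λ ()) , (λ ())

module _ {r : ℕ} .{{_ : NonZero r}} where

  merge-relabel : ∀ {a b u u' : Fin r} → a ≢ b → u ≢ u' →
    Σ (Fin r → Fin r) λ π → Injective _≡_ _≡_ π × a ⊕ π u ≡ b ⊕ π u'
  merge-relabel {a} {b} {u} {u'} a≢b u≢u' =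
    let π , π-inj , πu≡u , πu'≡q = retarget u≢u' u≢q in
    π , π-inj , (begin
      a ⊕ π u  ≡⟨ cong (a ⊕_) πu≡u ⟩
      a ⊕ u    ≡⟨ ⊕-solve b (a ⊕ u) ⟨
      b ⊕ q    ≡⟨ cong (b ⊕_) πu'≡q ⟨
      b ⊕ π u' ∎)
    where
    open ≡-Reasoning
    q : Fin r
    q = (a ⊕ u) ⊖ b
    u≢q : u ≢ q
    u≢q u≡q = a≢b (sym (⊕-cancelʳ (trans (cong (b ⊕_) u≡q) (⊕-solve b (a ⊕ u)))))

  separate-relabel : 3 ≤ r → ∀ {a b u u' : Fin r} → a ≢ b → u ≢ u' →
    Σ (Fin r → Fin r) λ π → Injective _≡_ _≡_ π × a ⊕ π u ≢ b ⊕ π u'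
  separate-relabel r≥3 {a} {b} {u} {u'} a≢b u≢u' =
    let s , s≢u , s≢q = avoidTwo r≥3 u q
        π , π-inj , πu≡u , πu'≡s = retarget u≢u' (λ u≡s → s≢u (sym u≡s))
    in π , π-inj , λ e → s≢q (⊕-cancelˡ (begin
      b ⊕ s    ≡⟨ cong (b ⊕_) πu'≡s ⟨
      b ⊕ π u' ≡⟨ e ⟨
      a ⊕ π u  ≡⟨ cong (a ⊕_) πu≡u ⟩
      a ⊕ u    ≡⟨ ⊕-solve b (a ⊕ u) ⟨
      b ⊕ q    ∎))
    where
    open ≡-Reasoning
    q : Fin r
    q = (a ⊕ u) ⊖ b

module _ {r : ℕ} where

  hamming-loopless : ∀ {n} → Loopless (CartesianPowK r n)
  hamming-loopless (i , differ , _) refl = differ refl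

  head-step : ∀ {n} {a b : Fin r} {x : Vertex r n} → a ≢ b → CartesianPowK r (suc n) (a ∷ x) (b ∷ x)
  head-step a≢b = zero , a≢b , λ { zero 0≢0 → ⊥-elim (0≢0 refl) ; (suc j) _ → refl }

  tail-step : ∀ {n} {a : Fin r} {x y : Vertex r n} →
    CartesianPowK r n x y → CartesianPowK r (suc n) (a ∷ x) (a ∷ y)
  tail-step (i , differ , agree) =
    suc i , differ , λ { zero _ → refl ; (suc j) j≢i → agree j (λ j≡i → j≢i (cong suc j≡i)) }

  hamming-uncons : ∀ {n} {a b : Fin r} {x y : Vertex r n} → CartesianPowK r (suc n) (a ∷ x) (b ∷ y) →
    (a ≢ b × x ≡ y) ⊎ (a ≡ b × CartesianPowK r n x y)
  hamming-uncons (zero , differ , agree) = inj₁ (differ , lookup-ext λ j → agree (suc j) (λ ()))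
  hamming-uncons (suc i , differ , agree) =
    inj₂ (agree zero (λ ()) , i , differ , λ j j≢i → agree (suc j) (λ e → j≢i (suc-injective e)))

  AgreeOff : ∀ {n} → Fin n → Vertex r n → Vertex r n → Set
  AgreeOff i x y = ∀ j → j ≢ i → lookup x j ≡ lookup y j

  Adjacent : ∀ {n} → Fin n → Vertex r n → Vertex r n → Set
  Adjacent i x y = (lookup x i ≢ lookup y i) × AgreeOff i x y

  agreeOff⇒≡⊎adjacent : ∀ {n} {i : Fin n} {x y : Vertex r n} → AgreeOff i x y →
    x ≡ y ⊎ CartesianPowK r n x y
  agreeOff⇒≡⊎adjacent {i = i} {x} {y} agree with lookup x i ≟ lookup y i
  ... | no differ = inj₂ (i , differ , agree)
  ... | yes same = inj₁ (lookup-ext entry)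
    where
    entry : ∀ j → lookup x j ≡ lookup y j
    entry j with j ≟ i
    ... | yes refl = same
    ... | no j≢i = agree j j≢i

  adjacent-transfer : ∀ {n} {i k : Fin n} {x y x' y' : Vertex r n} → k ≢ i →
    lookup x i ≡ lookup y i → AgreeOff i x' x → AgreeOff i y' y → Adjacent k x' y' → Adjacent k x y
  adjacent-transfer {i = i} {k} {x} {y} {x'} {y'} k≢i same-at-i x'~x y'~y (differ , agree) =
    (λ e → differ (trans (x'~x k k≢i) (trans e (sym (y'~y k k≢i))))) , agree-off-k
    where
    agree-off-k : AgreeOff k x y
    agree-off-k j j≢k with j ≟ i
    ... | yes refl = same-at-i
    ... | no j≢i = trans (sym (x'~x j j≢i)) (trans (agree j j≢k) (y'~y j j≢i))

  -- Hamming distance at least two, by recursion on the coordinates.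
  Far : ∀ {n} → Vertex r n → Vertex r n → Set
  Far [] [] = ⊥
  Far (a ∷ x) (b ∷ y) = (a ≢ b × x ≢ y) ⊎ (a ≡ b × Far x y)

  hamming-trichotomy : ∀ {n} (x y : Vertex r n) → x ≢ y → CartesianPowK r n x y ⊎ Far x y
  hamming-trichotomy [] [] []≢[] = ⊥-elim ([]≢[] refl)
  hamming-trichotomy (a ∷ x) (b ∷ y) ne with a ≟ b | ≡-dec _≟_ x y
  ... | yes refl | yes refl = ⊥-elim (ne refl)
  ... | no a≢b   | yes refl = inj₁ (head-step a≢b)
  ... | no a≢b   | no x≢y   = inj₂ (inj₁ (a≢b , x≢y))
  ... | yes refl | no x≢y with hamming-trichotomy x y x≢y
  ...   | inj₁ adjacent = inj₁ (tail-step adjacent)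
  ...   | inj₂ far = inj₂ (inj₂ (refl , far))

module _ {r : ℕ} .{{_ : NonZero r}} where

  Proper : ∀ {n} → (Vertex r n → Fin r) → Set
  Proper {n} c = ∀ x y → CartesianPowK r n x y → c x ≢ c y

  ProperColouring : ℕ → Set
  ProperColouring n = Σ (Vertex r n → Fin r) Proper

  relabel : ∀ {n} {π : Fin r → Fin r} → Injective _≡_ _≡_ π → ProperColouring n → ProperColouring n
  relabel {π = π} π-inj (c , proper) = (λ x → π (c x)) , λ x y adj e → proper x y adj (π-inj e)

  extendColour : ∀ {n} → (Vertex r n → Fin r) → Vertex r (suc n) → Fin r
  extendColour c (h ∷ t) = h ⊕ c t

  -- (h ∷ t) ↦ h ⊕ c t is proper: a head step changes h, a tail step changes c t.
  extend : ∀ {n} → ProperColouring n → ProperColouring (suc n)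
  extend (c , proper) = extendColour c , extended
    where
    extended : Proper (extendColour c)
    extended (a ∷ x) (b ∷ y) adj with hamming-uncons adj
    ... | inj₁ (a≢b , refl)      = λ e → a≢b (⊕-cancelʳ e)
    ... | inj₂ (refl , adjacent) = λ e → proper x y adjacent (⊕-cancelˡ e)

  standard : ∀ n → ProperColouring n
  standard zero = (λ _ → 0ᶠ) , λ { [] [] (() , _) }
  standard (suc n) = extend (standard n)

  separating : 3 ≤ r → ∀ {n} (x y : Vertex r n) → x ≢ y →
    Σ (ProperColouring n) λ (c , _) → c x ≢ c y
  separating r≥3 [] [] []≢[] = ⊥-elim ([]≢[] refl)
  separating r≥3 (a ∷ x) (b ∷ y) ne with a ≟ b | ≡-dec _≟_ x y
  ... | yes refl | yes refl = ⊥-elim (ne refl)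
  ... | no a≢b   | yes refl = extend (standard _) , λ e → a≢b (⊕-cancelʳ e)
  ... | yes refl | no x≢y =
    let c , cx≢cy = separating r≥3 x y x≢y in extend c , λ e → cx≢cy (⊕-cancelˡ e)
  ... | no a≢b   | no x≢y =
    let c , cx≢cy = separating r≥3 x y x≢y
        π , π-inj , separated = separate-relabel r≥3 a≢b cx≢cy
    in extend (relabel π-inj c) , separated

  merging : 3 ≤ r → ∀ {n} (x y : Vertex r n) → Far x y →
    Σ (ProperColouring n) λ (c , _) → c x ≡ c y
  merging r≥3 [] [] ()
  merging r≥3 (a ∷ x) (b ∷ y) (inj₁ (a≢b , x≢y)) =
    let c , cx≢cy = separating r≥3 x y x≢y
        π , π-inj , merged = merge-relabel a≢b cx≢cy
    in extend (relabel π-inj c) , merged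
  merging r≥3 (a ∷ x) (b ∷ y) (inj₂ (refl , far)) =
    let c , cx≡cy = merging r≥3 x y far in extend c , cong (a ⊕_) cx≡cy

  line-endo : ∀ {m} (t : Vertex r m) {c : Vertex r (suc m) → Fin r} → Proper c →
    IsEndo (CartesianPowK r (suc m)) (λ x → c x ∷ t)
  line-endo t proper x y adjacent = head-step (proper x y adjacent)

  hamming-hull : 3 ≤ r → ∀ {m} → IsHull (CartesianPowK r (suc m))
  hamming-hull r≥3 {m} = hull-criterion hamming-loopless adjacent-or-merged
    where
    adjacent-or-merged : ∀ v w → v ≢ w →
      CartesianPowK r (suc m) v w ⊎ MergedByEndo (CartesianPowK r (suc m)) v w
    adjacent-or-merged v w v≢w with hamming-trichotomy v w v≢w
    ... | inj₁ adjacent = inj₁ adjacent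
    ... | inj₂ far =
      let (c , proper) , cv≡cw = merging r≥3 v w far
          t = replicate m 0ᶠ
      in inj₂ ((λ x → c x ∷ t) , line-endo t proper , cong (_∷ t) cv≡cw)

  update-agreeOff : ∀ {n} (i : Fin n) (x : Vertex r n) (a : Fin r) → AgreeOff i (x [ i ]≔ a) x
  update-agreeOff i x a j j≢i = lookup∘update′ j≢i x a

  flatten : ∀ {n} → Fin n → Vertex r n → Vertex r n
  flatten i x = x [ i ]≔ 0ᶠ

  fold : ∀ {n} → Fin n → (Vertex r n → Fin r) → Vertex r n → Vertex r n
  fold i c x = flatten i x [ i ]≔ c (flatten i x)

  flatten-same-at : ∀ {n} (i : Fin n) (x y : Vertex r n) → lookup (flatten i x) i ≡ lookup (flatten i y) i
  flatten-same-at i x y = trans (lookup∘update i x 0ᶠ) (sym (lookup∘update i y 0ᶠ))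

  fold-agreeOff : ∀ {n} (i : Fin n) (c : Vertex r n → Fin r) (x : Vertex r n) → AgreeOff i (fold i c x) x
  fold-agreeOff i c x j j≢i =
    trans (update-agreeOff i (flatten i x) (c (flatten i x)) j j≢i) (update-agreeOff i x 0ᶠ j j≢i)

  -- The fold only sees coordinates other than i, so it identifies i-neighbours.
  fold-merges : ∀ {n} {i : Fin n} (c : Vertex r n → Fin r) {x y : Vertex r n} →
    Adjacent i x y → fold i c x ≡ fold i c y
  fold-merges {i = i} c {x} {y} (_ , agree) = cong (λ u → u [ i ]≔ c u) (lookup-ext entry)
    where
    entry : ∀ j → lookup (flatten i x) j ≡ lookup (flatten i y) j
    entry j with j ≟ i
    ... | yes refl = flatten-same-at i x y
    ... | no j≢i = trans (update-agreeOff i x 0ᶠ j j≢i) (trans (agree j j≢i) (sym (update-agreeOff i y 0ᶠ j j≢i)))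

  -- If the folds of x and y are equal or adjacent, then so are x and y: agreement off i
  -- pulls back directly, and a k-step with k ≢ i would force equal colours on the
  -- k-adjacent flattenings.
  fold-endo : ∀ {n} (i : Fin n) {c : Vertex r n → Fin r} → Proper c →
    IsEndo (Complement (CartesianPowK r n)) (fold i c)
  fold-endo {n} i {c} proper x y (x≢y , ¬adjacent) = fold-distinct , fold-nonadjacent
    where
    excluded : x ≡ y ⊎ CartesianPowK r n x y → ⊥
    excluded (inj₁ x≡y) = x≢y x≡y
    excluded (inj₂ adjacent) = ¬adjacent adjacent

    unfold : AgreeOff i (fold i c x) (fold i c y) → x ≡ y ⊎ CartesianPowK r n x y
    unfold agree = agreeOff⇒≡⊎adjacent λ j j≢i →
      trans (sym (fold-agreeOff i c x j j≢i)) (trans (agree j j≢i) (fold-agreeOff i c y j j≢i))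

    fold-distinct : fold i c x ≢ fold i c y
    fold-distinct e = excluded (unfold λ j _ → cong (λ u → lookup u j) e)

    fold-nonadjacent : ¬ CartesianPowK r n (fold i c x) (fold i c y)
    fold-nonadjacent (k , differ , agree) with k ≟ i
    ... | yes refl = excluded (unfold agree)
    ... | no k≢i = proper (flatten i x) (flatten i y) flat-adjacent same-colour
      where
      flat-adjacent : CartesianPowK r n (flatten i x) (flatten i y)
      flat-adjacent = k , adjacent-transfer {x = flatten i x} {flatten i y} {fold i c x} {fold i c y}
        k≢i (flatten-same-at i x y)
        (update-agreeOff i (flatten i x) (c (flatten i x)))
        (update-agreeOff i (flatten i y) (c (flatten i y))) (differ , agree)
      same-colour : c (flatten i x) ≡ c (flatten i y)
      same-colour = trans (sym (lookup∘update i (flatten i x) _))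
        (trans (agree i (λ i≡k → k≢i (sym i≡k))) (lookup∘update i (flatten i y) _))

  hamming-complement-hull : ∀ {n} → IsHull (Complement (CartesianPowK r n))
  hamming-complement-hull {n} with standard n
  ... | c , proper = complement-hull-criterion λ v w (i , adjacent) →
    fold i c , fold-endo i proper , fold-merges c adjacent

module _ {r : ℕ} where

  categorical-loopless : ∀ {m} → Loopless (CategoricalPowK r (suc m))
  categorical-loopless adjacent refl = adjacent zero refl

  -- x ↦ (x_i, …, x_i); adjacency in every coordinate survives since it holds at i.
  diagonal : ∀ {n} → Fin n → Vertex r n → Vertex r n
  diagonal i x = replicate _ (lookup x i)

  diagonal-endo : ∀ {n} (i : Fin n) → IsEndo (CategoricalPowK r n) (diagonal i)
  diagonal-endo i x y adjacent j e =
    adjacent i (trans (sym (lookup-replicate j (lookup x i))) (trans e (lookup-replicate j (lookup y i))))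

  -- Part (2), categorical power: non-adjacent vertices agree at some i, where diagonal i
  -- merges them.
  categorical-hull : ∀ {m} → IsHull (CategoricalPowK r (suc m))
  categorical-hull {m} = hull-criterion categorical-loopless adjacent-or-merged
    where
    adjacent-or-merged : ∀ v w → v ≢ w →
      CategoricalPowK r (suc m) v w ⊎ MergedByEndo (CategoricalPowK r (suc m)) v w
    adjacent-or-merged v w _ with any? (λ i → lookup v i ≟ lookup w i)
    ... | yes (i , same) = inj₂ (diagonal i , diagonal-endo i , cong (replicate _) same)
    ... | no never-same = inj₁ λ i same → never-same (i , same)

module _ {r : ℕ} .{{_ : NonZero r}} where

  squash : ∀ {m} → (Fin m → Fin r → Fin r) → Vertex r (suc m) → Vertex r (suc m)
  squash π (h ∷ t) = 0ᶠ ∷ tabulate (λ k → h ⊕ π k (lookup t k))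

  squash-entry : ∀ {m} (π : Fin m → Fin r → Fin r) h t k →
    lookup (squash π (h ∷ t)) (suc k) ≡ h ⊕ π k (lookup t k)
  squash-entry π h t = lookup∘tabulate (λ k → h ⊕ π k (lookup t k))

  -- Images of squash all agree at coordinate 0, so they are never adjacent; and if two
  -- images coincide, the preimages are equal (when their heads agree) or adjacent (when
  -- they differ), by cancellation and injectivity of the π k.
  squash-endo : ∀ {m} {π : Fin m → Fin r → Fin r} → (∀ k → Injective _≡_ _≡_ (π k)) →
    IsEndo (Complement (CategoricalPowK r (suc m))) (squash π)
  squash-endo {m} {π} π-inj (h ∷ t) (h' ∷ t') (x≢y , ¬adjacent) =
    squash-distinct , λ adjacent → adjacent zero refl
    where
    squash-distinct : squash π (h ∷ t) ≢ squash π (h' ∷ t')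
    squash-distinct e = ¬adjacent adjacent
      where
      same-entry : ∀ k → h ⊕ π k (lookup t k) ≡ h' ⊕ π k (lookup t' k)
      same-entry k = trans (sym (squash-entry π h t k))
        (trans (cong (λ u → lookup u (suc k)) e) (squash-entry π h' t' k))
      h≢h' : h ≢ h'
      h≢h' refl = x≢y (cong (h ∷_) (lookup-ext λ k → π-inj k (⊕-cancelˡ (same-entry k))))
      adjacent : CategoricalPowK r (suc m) (h ∷ t) (h' ∷ t')
      adjacent zero = h≢h'
      adjacent (suc k) tk≡t'k =
        h≢h' (⊕-cancelʳ (trans (same-entry k) (cong (λ u → h' ⊕ π k u) (sym tk≡t'k))))

  squash-merges : ∀ {m} {π : Fin m → Fin r → Fin r} {a b x y} →
    (∀ k → a ⊕ π k (lookup x k) ≡ b ⊕ π k (lookup y k)) → squash π (a ∷ x) ≡ squash π (b ∷ y)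
  squash-merges merged = cong (0ᶠ ∷_) (tabulate-cong merged)

  categorical-complement-hull : ∀ {m} → IsHull (Complement (CategoricalPowK r (suc m)))
  categorical-complement-hull {m} = complement-hull-criterion merge-adjacent
    where
    merge-adjacent : ∀ v w → CategoricalPowK r (suc m) v w →
      MergedByEndo (Complement (CategoricalPowK r (suc m))) v w
    merge-adjacent (a ∷ x) (b ∷ y) adjacent =
      squash π , squash-endo π-inj , squash-merges {π = π} {a} {b} {x} {y} merged
      where
      relabelling : ∀ k → Σ (Fin r → Fin r) λ ρ →
        Injective _≡_ _≡_ ρ × a ⊕ ρ (lookup x k) ≡ b ⊕ ρ (lookup y k)
      relabelling k = merge-relabel (adjacent zero) (adjacent (suc k))
      π : Fin m → Fin r → Fin r
      π k = proj₁ (relabelling k)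
      π-inj : ∀ k → Injective _≡_ _≡_ (π k)
      π-inj k = proj₁ (proj₂ (relabelling k))
      merged : ∀ k → a ⊕ π k (lookup x k) ≡ b ⊕ π k (lookup y k)
      merged k = proj₂ (proj₂ (relabelling k))

mainTheorem9 : (n r : ℕ) → 2 ≤ n → 3 ≤ r →
    (IsHull (CartesianPowK r n) × IsHull (Complement (CartesianPowK r n)))
    × (IsHull (CategoricalPowK r n) × IsHull (Complement (CategoricalPowK r n)))
mainTheorem9 (suc m) (suc k) (s≤s _) r≥3 =
  (hamming-hull r≥3 , hamming-complement-hull) , (categorical-hull , categorical-complement-hull)
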